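{- Let $H$ be a real symmetric matrix (weighted undirected graph) with cospectral vertices $u,v$, and let $c$ be a vertex of $H$ that is a walk singlet of $H$ relative to $u,v$ with parity $p \in \{+1,-1\}$. Let $C$ be an arbitrary weighted undirected graph (real symmetric matrix) on a new vertex set disjoint from that of $H$, and let $H'$ be the graph obtained from the disjoint union of $H$ and $C$ by adding any number of edges, with arbitrary real weights, between $c$ and vertices of $C$ (and no other edges between $H$ and $C$). Then every vertex $c'$ of $C$ is a walk singlet of $H'$ relative to $u,v$ with parity $p$, i.e. $[H'^k]_{u,c'} = p\,[H'^k]_{v,c'}$ for all integers $k \geq 0$.
   Context: A real symmetric matrix is identified with an undirected weighted graph, with edge weight $H_{i,j}$ between vertices $i,j$ (diagonal entries are loops). Two vertices $u,v$ are cospectral in $H$ if $[H^k]_{u,u} = [H^k]_{v,v}$ for all integers $k \geq 0$. A vertex $c$ is a walk singlet of $H$ relative to $u,v$ with parity $p \in \{+1,-1\}$ (even if $p=+1$, odd if $p=-1$) if $[H^k]_{u,c} = p\,[H^k]_{v,c}$ for all integers $k \geq 0$. -}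

module Defs where

open import Level using (Level)
open import Algebra.Bundles using (CommutativeRing)
open import Data.Nat using (ℕ; zero; suc) renaming (_+_ to _+ℕ_)
open import Data.Fin using (Fin; zero; suc; splitAt; _≟_)
open import Data.Sum using (_⊎_; inj₁; inj₂)
open import Relation.Nullary using (yes; no)

module MatrixDefs {c ℓ : Level} (R : CommutativeRing c ℓ) where
  open CommutativeRing R using (Carrier; _≈_; _+_; _*_; -_; 0#; 1#)

  Matrix : ℕ → Set c
  Matrix n = Fin n → Fin n → Carrier

  sumF : ∀ {n} → (Fin n → Carrier) → Carrier
  sumF {zero}  f = 0#
  sumF {suc n} f = f zero + sumF (λ i → f (suc i))

  identity : ∀ {n} → Matrix n
  identity i j with i ≟ j
  ... | yes _ = 1#
  ... | no  _ = 0#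

  mul : ∀ {n} → Matrix n → Matrix n → Matrix n
  mul M N i j = sumF (λ k → M i k * N k j)

  pow : ∀ {n} → Matrix n → ℕ → Matrix n
  pow M zero    = identity
  pow M (suc k) = mul M (pow M k)

  Symmetric : ∀ {n} → Matrix n → Set ℓ
  Symmetric M = ∀ i j → M i j ≈ M j i

  Cospectral : ∀ {n} → Matrix n → Fin n → Fin n → Set ℓ
  Cospectral H u v = ∀ k → pow H k u u ≈ pow H k v v

  IsParity : Carrier → Set ℓ
  IsParity p = (p ≈ 1#) ⊎ (p ≈ - 1#)

  WalkSinglet : ∀ {n} → Matrix n → Fin n → Fin n → Carrier → Fin n → Set ℓ
  WalkSinglet H u v p c = ∀ k → pow H k u c ≈ p * pow H k v c

  -- H' on vertex set Fin (n + m): vertices of H are  a ↑ˡ m,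
  -- vertices of C are  n ↑ʳ b.  The edges between H and C are exactly the
  -- edges c — b of weight w b (w b = 0 means no edge).
  attach : ∀ {n m} → Matrix n → Fin n → Matrix m → (Fin m → Carrier)
         → Matrix (n +ℕ m)
  attach {n} {m} H c C w i j with splitAt n i | splitAt n j
  ... | inj₁ a | inj₁ a' = H a a'
  ... | inj₂ b | inj₂ b' = C b b'
  ... | inj₁ a | inj₂ b' with a ≟ c
  ...   | yes _ = w b'
  ...   | no  _ = 0#
  attach {n} {m} H c C w i j | inj₂ b | inj₁ a' with a' ≟ c
  ...   | yes _ = w b
  ...   | no  _ = 0#

-- Put d_k := (e_u − p e_v)ᵀ H'^k, so that d_{k+1} = d_k H' and c' is a walk
-- singlet of H' exactly when d_k vanishes at c' for all k.  By induction, d_k is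
-- the corresponding row a_k := (e_u − p e_v)ᵀ H^k of H extended by zero on C:
-- the only entry of a_k that reaches C in one step is a_k(c), which vanishes
-- because c is a walk singlet of H.  Symmetry, cospectrality and the value of
-- p play no role.
module Submission where

open import Defs
open import Level using (Level)
open import Algebra.Bundles using (CommutativeRing)
open import Data.Nat using (ℕ; zero; suc) renaming (_+_ to _+ℕ_)
open import Data.Fin using (Fin; _↑ˡ_; _↑ʳ_; _≟_; zero; suc; punchIn)
open import Data.Fin.Properties
  using (splitAt-↑ˡ; splitAt-↑ʳ; suc-injective; ↑ˡ-injective; punchInᵢ≢i)
open import Data.Vec.Functional using (Vector)
open import Data.Product using (_×_; _,_; proj₂)
open import Function using (_∘_)
open import Relation.Binary.PropositionalEquality as ≡ using (_≡_; _≢_)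
open import Relation.Nullary using (yes; no)
open import Data.Empty using (⊥-elim)
import Algebra.Properties.Ring as RingProperties
import Algebra.Properties.Semiring.Sum as SemiringSum
import Relation.Binary.Reasoning.Setoid as SetoidReasoning

↑ˡ≢↑ʳ : ∀ {n m} (i : Fin n) (j : Fin m) → i ↑ˡ m ≢ n ↑ʳ j
↑ˡ≢↑ʳ zero    j ()
↑ˡ≢↑ʳ (suc i) j eq = ↑ˡ≢↑ʳ i j (suc-injective eq)

module MatrixProperties {a ℓ : Level} (R : CommutativeRing a ℓ) where
  open CommutativeRing R hiding (zero)
  open MatrixDefs R
  open SemiringSum semiring
    using (sum; sum-syntax; sum-cong-≋; sum-cong-≗; sum-replicate-zero; sum-remove;
           ∑-comm; *-distribˡ-sum; *-distribʳ-sum)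
  open SetoidReasoning setoid

  sumF≡sum : ∀ {n} (f : Vector Carrier n) → sumF f ≡ sum f
  sumF≡sum {zero}  f = ≡.refl
  sumF≡sum {suc n} f = ≡.cong (f zero +_) (sumF≡sum (f ∘ suc))

  sum-zero : ∀ {n} {f : Vector Carrier n} → (∀ i → f i ≈ 0#) → sum f ≈ 0#
  sum-zero {n} f≈0 = trans (sum-cong-≋ f≈0) (sum-replicate-zero n)

  sum-single : ∀ {n} (f : Vector Carrier n) (i : Fin n) →
               (∀ j → j ≢ i → f j ≈ 0#) → sum f ≈ f i
  sum-single {suc n} f i f≈0 = begin
    sum f                               ≈⟨ sum-remove f ⟩
    f i + sum (λ j → f (punchIn i j))   ≈⟨ +-congˡ (sum-zero (λ j → f≈0 _ (punchInᵢ≢i i j))) ⟩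
    f i + 0#                            ≈⟨ +-identityʳ _ ⟩
    f i                                 ∎

  sum-↑ : ∀ n {m} (f : Vector Carrier (n +ℕ m)) →
          sum f ≈ sum (f ∘ (_↑ˡ m)) + sum (f ∘ (n ↑ʳ_))
  sum-↑ zero    f = sym (+-identityˡ _)
  sum-↑ (suc n) f = trans (+-congˡ (sum-↑ n (f ∘ suc))) (sym (+-assoc _ _ _))

  sum-↑ˡ : ∀ n {m} (f : Vector Carrier (n +ℕ m)) →
           (∀ b → f (n ↑ʳ b) ≈ 0#) → sum f ≈ sum (f ∘ (_↑ˡ m))
  sum-↑ˡ n {m} f f≈0 = begin
    sum f                                      ≈⟨ sum-↑ n f ⟩
    sum (f ∘ (_↑ˡ m)) + sum (f ∘ (n ↑ʳ_))      ≈⟨ +-congˡ (sum-zero f≈0) ⟩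
    sum (f ∘ (_↑ˡ m)) + 0#                     ≈⟨ +-identityʳ _ ⟩
    sum (f ∘ (_↑ˡ m))                          ∎

  mul-sum : ∀ {n} (A B : Matrix n) i j → mul A B i j ≡ ∑[ l < n ] (A i l * B l j)
  mul-sum A B i j = sumF≡sum (λ l → A i l * B l j)

  identity-diag : ∀ {n} (i : Fin n) → identity i i ≈ 1#
  identity-diag i with i ≟ i
  ... | yes _   = refl
  ... | no  i≢i = ⊥-elim (i≢i ≡.refl)

  identity-off : ∀ {n} {i j : Fin n} → i ≢ j → identity i j ≈ 0#
  identity-off {i = i} {j} i≢j with i ≟ j
  ... | yes i≡j = ⊥-elim (i≢j i≡j)
  ... | no  _   = refl

  identity-↑ˡ : ∀ {n} m (i j : Fin n) → identity (i ↑ˡ m) (j ↑ˡ m) ≈ identity i j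
  identity-↑ˡ m i j with i ≟ j
  ... | yes ≡.refl = identity-diag (i ↑ˡ m)
  ... | no  i≢j    = identity-off (i≢j ∘ ↑ˡ-injective m i j)

  mul-identityʳ : ∀ {n} (M : Matrix n) i j → mul M identity i j ≈ M i j
  mul-identityʳ M i j = begin
    mul M identity i j                   ≡⟨ mul-sum M identity i j ⟩
    ∑[ l < _ ] (M i l * identity l j)    ≈⟨ sum-single _ j (λ l l≢j → trans (*-congˡ (identity-off l≢j)) (zeroʳ _)) ⟩
    M i j * identity j j                 ≈⟨ *-congˡ (identity-diag j) ⟩
    M i j * 1#                           ≈⟨ *-identityʳ _ ⟩
    M i j                                ∎

  mul-identityˡ : ∀ {n} (M : Matrix n) i j → mul identity M i j ≈ M i j
  mul-identityˡ M i j = begin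
    mul identity M i j                   ≡⟨ mul-sum identity M i j ⟩
    ∑[ l < _ ] (identity i l * M l j)    ≈⟨ sum-single _ i (λ l l≢i → trans (*-congʳ (identity-off (l≢i ∘ ≡.sym))) (zeroˡ _)) ⟩
    identity i i * M i j                 ≈⟨ *-congʳ (identity-diag i) ⟩
    1# * M i j                           ≈⟨ *-identityˡ _ ⟩
    M i j                                ∎

  mul-assoc : ∀ {n} (A B C : Matrix n) i j → mul (mul A B) C i j ≈ mul A (mul B C) i j
  mul-assoc {n} A B C i j = begin
    mul (mul A B) C i j                                    ≡⟨ mul-sum (mul A B) C i j ⟩
    ∑[ z < n ] (mul A B i z * C z j)                       ≡⟨ sum-cong-≗ (λ z → ≡.cong (_* C z j) (mul-sum A B i z)) ⟩
    ∑[ z < n ] (∑[ l < n ] (A i l * B l z) * C z j)        ≈⟨ sum-cong-≋ (λ z → *-distribʳ-sum (C z j) (λ l → A i l * B l z)) ⟩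
    ∑[ z < n ] ∑[ l < n ] ((A i l * B l z) * C z j)        ≈⟨ ∑-comm (λ l z → (A i l * B l z) * C z j) ⟨
    ∑[ l < n ] ∑[ z < n ] ((A i l * B l z) * C z j)        ≈⟨ sum-cong-≋ (λ l → sum-cong-≋ (λ z → *-assoc (A i l) (B l z) (C z j))) ⟩
    ∑[ l < n ] ∑[ z < n ] (A i l * (B l z * C z j))        ≈⟨ sum-cong-≋ (λ l → *-distribˡ-sum (A i l) (λ z → B l z * C z j)) ⟨
    ∑[ l < n ] (A i l * ∑[ z < n ] (B l z * C z j))        ≡⟨ sum-cong-≗ (λ l → ≡.cong (A i l *_) (mul-sum B C l j)) ⟨
    ∑[ l < n ] (A i l * mul B C l j)                       ≡⟨ mul-sum A (mul B C) i j ⟨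
    mul A (mul B C) i j                                    ∎

  mul-congˡ : ∀ {n} (A : Matrix n) {B B′ : Matrix n} → (∀ i j → B i j ≈ B′ i j) →
              ∀ i j → mul A B i j ≈ mul A B′ i j
  mul-congˡ A {B} {B′} B≈B′ i j = begin
    mul A B i j                      ≡⟨ mul-sum A B i j ⟩
    ∑[ l < _ ] (A i l * B l j)       ≈⟨ sum-cong-≋ (λ l → *-congˡ (B≈B′ l j)) ⟩
    ∑[ l < _ ] (A i l * B′ l j)      ≡⟨ mul-sum A B′ i j ⟨
    mul A B′ i j                     ∎

  pow-sucʳ : ∀ {n} (M : Matrix n) k i j → pow M (suc k) i j ≈ mul (pow M k) M i j
  pow-sucʳ M zero    i j = trans (mul-identityʳ M i j) (sym (mul-identityˡ M i j))
  pow-sucʳ M (suc k) i j = begin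
    mul M (pow M (suc k)) i j          ≈⟨ mul-congˡ M (pow-sucʳ M k) i j ⟩
    mul M (mul (pow M k) M) i j        ≈⟨ mul-assoc M (pow M k) M i j ⟨
    mul (mul M (pow M k)) M i j        ∎

module AttachProperties {a ℓ : Level} (R : CommutativeRing a ℓ) where
  open CommutativeRing R hiding (zero)
  open MatrixDefs R
  open MatrixProperties R
  open SemiringSum semiring using (sum-syntax; sum-cong-≋; ∑-distrib-+; *-distribˡ-sum)
  open RingProperties ring using (-‿distribˡ-*; x∙y⁻¹≈ε⇒x≈y; x≈y⇒x∙y⁻¹≈ε)
  open SetoidReasoning setoid

  infixl 7 _ᵥ*_
  _ᵥ*_ : ∀ {n} → Vector Carrier n → Matrix n → Vector Carrier n
  (x ᵥ* M) j = ∑[ l < _ ] (x l * M l j)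

  walkComb : ∀ {n} → Matrix n → Fin n → Fin n → Carrier → ℕ → Vector Carrier n
  walkComb M u v q k j = pow M k u j + q * pow M k v j

  walkComb-suc : ∀ {n} (M : Matrix n) u v q k j →
                 walkComb M u v q (suc k) j ≈ (walkComb M u v q k ᵥ* M) j
  walkComb-suc {n} M u v q k j = begin
    pow M (suc k) u j + q * pow M (suc k) v j
      ≈⟨ +-cong (pow-sucʳ M k u j) (*-congˡ (pow-sucʳ M k v j)) ⟩
    mul (pow M k) M u j + q * mul (pow M k) M v j
      ≡⟨ ≡.cong₂ (λ x y → x + q * y) (mul-sum (pow M k) M u j) (mul-sum (pow M k) M v j) ⟩
    ∑[ l < n ] (Mᵏ u l * M l j) + q * ∑[ l < n ] (Mᵏ v l * M l j)
      ≈⟨ +-congˡ (*-distribˡ-sum q (λ l → Mᵏ v l * M l j)) ⟩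
    ∑[ l < n ] (Mᵏ u l * M l j) + ∑[ l < n ] (q * (Mᵏ v l * M l j))
      ≈⟨ ∑-distrib-+ (λ l → Mᵏ u l * M l j) (λ l → q * (Mᵏ v l * M l j)) ⟨
    ∑[ l < n ] (Mᵏ u l * M l j + q * (Mᵏ v l * M l j))
      ≈⟨ sum-cong-≋ (λ l → trans (+-congˡ (sym (*-assoc q (Mᵏ v l) (M l j))))
                                 (sym (distribʳ (M l j) (Mᵏ u l) (q * Mᵏ v l)))) ⟩
    ∑[ l < n ] ((Mᵏ u l + q * Mᵏ v l) * M l j)
      ∎
    where Mᵏ = pow M k

  walkSinglet⇒walkComb≈0 : ∀ {n} {M : Matrix n} {u v p c} →
                            WalkSinglet M u v p c → ∀ k → walkComb M u v (- p) k c ≈ 0#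
  walkSinglet⇒walkComb≈0 {M = M} {u} {v} {p} {c} singlet k =
    trans (+-congˡ (sym (-‿distribˡ-* p (pow M k v c)))) (x≈y⇒x∙y⁻¹≈ε (singlet k))

  walkComb≈0⇒walkSinglet : ∀ {n} {M : Matrix n} {u v p c} →
                            (∀ k → walkComb M u v (- p) k c ≈ 0#) → WalkSinglet M u v p c
  walkComb≈0⇒walkSinglet {M = M} {u} {v} {p} {c} vanish k =
    x∙y⁻¹≈ε⇒x≈y _ _ (trans (+-congˡ (-‿distribˡ-* p (pow M k v c))) (vanish k))

  ExtendsByZero : ∀ {n m} → Vector Carrier (n +ℕ m) → Vector Carrier n → Set ℓ
  ExtendsByZero {n} {m} d a = (∀ x → d (x ↑ˡ m) ≈ a x) × (∀ b → d (n ↑ʳ b) ≈ 0#)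

  ExtendsByZero-resp : ∀ {n m} {d d′ : Vector Carrier (n +ℕ m)} {a a′ : Vector Carrier n} →
                       (∀ j → d j ≈ d′ j) → (∀ x → a x ≈ a′ x) →
                       ExtendsByZero d a → ExtendsByZero d′ a′
  ExtendsByZero-resp d≈d′ a≈a′ (onH , onC) =
    (λ x → trans (sym (d≈d′ _)) (trans (onH x) (a≈a′ x))) ,
    (λ b → trans (sym (d≈d′ _)) (onC b))

  ExtendsByZero-lincomb : ∀ {n m} {d d′ : Vector Carrier (n +ℕ m)} {a a′ : Vector Carrier n} q →
                          ExtendsByZero d a → ExtendsByZero d′ a′ →
                          ExtendsByZero (λ j → d j + q * d′ j) (λ x → a x + q * a′ x)
  ExtendsByZero-lincomb q (onH , onC) (onH′ , onC′) =
    (λ x → +-cong (onH x) (*-congˡ (onH′ x))) ,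
    (λ b → trans (+-cong (onC b) (*-congˡ (onC′ b))) (trans (+-identityˡ _) (zeroʳ q)))

  identity-extendsByZero : ∀ {n m} (u : Fin n) → ExtendsByZero (identity (u ↑ˡ m)) (identity u)
  identity-extendsByZero {m = m} u = identity-↑ˡ m u , λ b → identity-off (↑ˡ≢↑ʳ u b)

  attach-↑ˡ-↑ˡ : ∀ {n m} (H : Matrix n) c (C : Matrix m) w x y →
                 attach H c C w (x ↑ˡ m) (y ↑ˡ m) ≡ H x y
  attach-↑ˡ-↑ˡ {n} {m} H c C w x y rewrite splitAt-↑ˡ n x m | splitAt-↑ˡ n y m = ≡.refl

  attach-↑ˡ-↑ʳ : ∀ {n m} (H : Matrix n) c (C : Matrix m) w {x} b →
                 x ≢ c → attach H c C w (x ↑ˡ m) (n ↑ʳ b) ≡ 0#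
  attach-↑ˡ-↑ʳ {n} {m} H c C w {x} b x≢c rewrite splitAt-↑ˡ n x m | splitAt-↑ʳ n m b with x ≟ c
  ... | yes x≡c = ⊥-elim (x≢c x≡c)
  ... | no  _   = ≡.refl

  ᵥ*-attach : ∀ {n m} (H : Matrix n) c (C : Matrix m) w {d a} →
              ExtendsByZero d a → a c ≈ 0# →
              ExtendsByZero (d ᵥ* attach H c C w) (a ᵥ* H)
  ᵥ*-attach {n} {m} H c C w {d} {a} (onH , onC) ac≈0 = onH′ , onC′
    where
    G = attach H c C w

    restrict : ∀ j → (d ᵥ* G) j ≈ ∑[ x < n ] (a x * G (x ↑ˡ m) j)
    restrict j = begin
      ∑[ l < n +ℕ m ] (d l * G l j)
        ≈⟨ sum-↑ˡ n (λ l → d l * G l j) (λ b → trans (*-congʳ (onC b)) (zeroˡ _)) ⟩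
      ∑[ x < n ] (d (x ↑ˡ m) * G (x ↑ˡ m) j)
        ≈⟨ sum-cong-≋ (λ x → *-congʳ (onH x)) ⟩
      ∑[ x < n ] (a x * G (x ↑ˡ m) j)
        ∎

    onH′ : ∀ y → (d ᵥ* G) (y ↑ˡ m) ≈ (a ᵥ* H) y
    onH′ y = trans (restrict (y ↑ˡ m))
                   (sum-cong-≋ (λ x → *-congˡ (reflexive (attach-↑ˡ-↑ˡ H c C w x y))))

    onC′ : ∀ b → (d ᵥ* G) (n ↑ʳ b) ≈ 0#
    onC′ b = begin
      (d ᵥ* G) (n ↑ʳ b)
        ≈⟨ restrict (n ↑ʳ b) ⟩
      ∑[ x < n ] (a x * G (x ↑ˡ m) (n ↑ʳ b))
        ≈⟨ sum-single _ c (λ x x≢c → trans (*-congˡ (reflexive (attach-↑ˡ-↑ʳ H c C w b x≢c))) (zeroʳ _)) ⟩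
      a c * G (c ↑ˡ m) (n ↑ʳ b)
        ≈⟨ *-congʳ ac≈0 ⟩
      0# * G (c ↑ˡ m) (n ↑ʳ b)
        ≈⟨ zeroˡ _ ⟩
      0#
        ∎

  walkComb-attach : ∀ {n m} (H : Matrix n) c (C : Matrix m) w {u v} q →
                    (∀ k → walkComb H u v q k c ≈ 0#) → ∀ k →
                    ExtendsByZero (walkComb (attach H c C w) (u ↑ˡ m) (v ↑ˡ m) q k)
                                  (walkComb H u v q k)
  walkComb-attach {m = m} H c C w {u} {v} q vanish zero =
    ExtendsByZero-lincomb {d = identity (u ↑ˡ m)} {identity (v ↑ˡ m)} q
      (identity-extendsByZero u) (identity-extendsByZero v)
  walkComb-attach H c C w {u} {v} q vanish (suc k) =
    ExtendsByZero-resp (sym ∘ walkComb-suc (attach H c C w) _ _ q k) (sym ∘ walkComb-suc H u v q k)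
      (ᵥ*-attach H c C w (walkComb-attach H c C w q vanish k) (vanish k))

  walkSinglet-attach : ∀ {n m} (H : Matrix n) {u v p c} → WalkSinglet H u v p c →
                       (C : Matrix m) (w : Vector Carrier m) (c′ : Fin m) →
                       WalkSinglet (attach H c C w) (u ↑ˡ m) (v ↑ˡ m) p (n ↑ʳ c′)
  walkSinglet-attach H {p = p} {c} singlet C w c′ = walkComb≈0⇒walkSinglet λ k →
    proj₂ (walkComb-attach H c C w (- p) (walkSinglet⇒walkComb≈0 singlet) k) c′

corollary1 : ∀ {a ℓ : Level} (R : CommutativeRing a ℓ) →
    let open MatrixDefs R in
    ∀ {n m : ℕ} (H : Matrix n) → Symmetric H →
    (u v : Fin n) → Cospectral H u v →
    (c : Fin n) (p : CommutativeRing.Carrier R) → IsParity p → WalkSinglet H u v p c →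
    (C : Matrix m) → Symmetric C → (w : Fin m → CommutativeRing.Carrier R) →
    (c' : Fin m) →
    WalkSinglet (attach H c C w) (u ↑ˡ m) (v ↑ˡ m) p (n ↑ʳ c')
corollary1 R H _ _ _ _ _ _ _ singlet C _ w c' =
  AttachProperties.walkSinglet-attach R H singlet C w c'
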